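{- The graph $P_2\times K_8$ has a $(8;p,q)$-decomposition.
   Context: $P_k$ denotes a path of length $k$ (with $k$ edges, $k+1$ vertices), so $P_2$ is the path on $3$ vertices; $C_k$ denotes a cycle with $k$ edges; $K_n$ is the complete graph on $n$ vertices. The tensor product $G\times H$ has vertex set $V(G)\times V(H)$, with $(g_1,h_1)(g_2,h_2)$ an edge whenever $g_1g_2\in E(G)$ and $h_1h_2\in E(H)$. A graph $G$ has a $(8;p,q)$-decomposition if, for some nonnegative integers $p,q$ with $8(p+q)=|E(G)|$, the edge set of $G$ can be partitioned into $p$ copies of $P_8$ and $q$ copies of $C_8$. -}

module Defs where

open import Data.Nat using (ℕ; zero; suc; _*_; _≡ᵇ_; _<ᵇ_)
open import Data.Bool using (Bool; true; false; _∧_; _∨_; not)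
open import Data.Fin using (Fin; toℕ; remQuot)
open import Data.List using (List; length; filter; allFin; concatMap; map)
open import Data.Product using (Σ; _×_; _,_; proj₁; proj₂; ∃; ∃-syntax)
open import Data.Sum using (_⊎_)
open import Relation.Binary.PropositionalEquality using (_≡_)
open import Relation.Nullary.Decidable using (does)
open import Data.Bool.Properties using (T?)
open import Data.Bool using (T)
open import Function.Definitions using (Injective)

-- A finite (simple) graph on vertex set Fin n, given by a Boolean adjacency
-- relation (all graphs used below are symmetric and loopless).
record Graph : Set where
  field
    n   : ℕ
    Adj : Fin n → Fin n → Bool
open Graph public

_==_ : ∀ {n} → Fin n → Fin n → Bool
i == j = toℕ i ≡ᵇ toℕ j

-- P_k : path with k edges, on k+1 vertices 0,1,...,k
P : ℕ → Graph
P k = record { n = suc k ; Adj = λ i j → (suc (toℕ i) ≡ᵇ toℕ j) ∨ (suc (toℕ j) ≡ᵇ toℕ i) }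

private
  succMod : ℕ → ℕ → ℕ → Bool
  succMod k a b = (suc a ≡ᵇ b) ∨ ((suc a ≡ᵇ k) ∧ (b ≡ᵇ 0))

C : ℕ → Graph
C k = record { n = k ; Adj = λ i j → succMod k (toℕ i) (toℕ j) ∨ succMod k (toℕ j) (toℕ i) }

K : ℕ → Graph
K m = record { n = m ; Adj = λ i j → not (i == j) }

-- Tensor product G × H; vertex set Fin (n G * n H) ≅ Fin (n G) × Fin (n H) via remQuot
_⊗_ : Graph → Graph → Graph
G ⊗ H = record
  { n = n G * n H
  ; Adj = λ x y → let (g₁ , h₁) = remQuot {n G} (n H) x
                      (g₂ , h₂) = remQuot {n G} (n H) y
                  in Adj G g₁ g₂ ∧ Adj H h₁ h₂ }

edgeCount : Graph → ℕ
edgeCount G = length (filter (λ e → T? ((toℕ (proj₁ e) <ᵇ toℕ (proj₂ e)) ∧ Adj G (proj₁ e) (proj₂ e)))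
                             (concatMap (λ i → map (i ,_) (allFin (n G))) (allFin (n G))))

Copy : Graph → Graph → Set
Copy H G = Σ (Fin (n H) → Fin (n G)) λ f →
             Injective _≡_ _≡_ f × (∀ i j → T (Adj H i j) → T (Adj G (f i) (f j)))

Covers : (H G : Graph) → Copy H G → Fin (n G) → Fin (n G) → Set
Covers H G (f , _) u v = ∃[ i ] ∃[ j ] (T (Adj H i j) × f i ≡ u × f j ≡ v)

HasDecomposition : ℕ → ℕ → ℕ → Graph → Set
HasDecomposition k p q G =
  k * (p Data.Nat.+ q) ≡ edgeCount G ×
  Σ (Fin p → Copy (P k) G) λ paths →
  Σ (Fin q → Copy (C k) G) λ cycles →
    let piece : Fin p ⊎ Fin q → Σ Graph λ H → Copy H G
        piece = Data.Sum.[ (λ a → P k , paths a) , (λ b → C k , cycles b) ]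
    in ∀ u v → T (Adj G u v) →
         Σ (Fin p ⊎ Fin q) λ s → Covers (proj₁ (piece s)) G (proj₂ (piece s)) u v ×
           (∀ s′ → Covers (proj₁ (piece s′)) G (proj₂ (piece s′)) u v → s′ ≡ s)

-- An explicit decomposition of the 112 edges of P₂ × K₈ into 9 paths and 5 cycles of length 8,
-- verified by exhaustive computation.  Every edge is covered by some piece; for edge-disjointness,
-- each edge of each piece is checked to have that piece as the first piece covering it, so no
-- edge can lie in two pieces.
module Submission where

open import Defs
open import Data.Bool using (Bool; true; false; T; _∧_; if_then_else_)
open import Data.Bool.Properties using (T-∧; T-≡)
open import Data.Empty using (⊥-elim)
open import Data.Fin using (Fin; zero; suc; toℕ; combine; splitAt; join)
open import Data.Fin.Properties using (toℕ-injective; splitAt-join; _≟_)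
open import Data.Maybe using (Maybe; just; nothing; is-just)
open import Data.Maybe.Properties using (just-injective)
import Data.Maybe.Properties as Maybe
open import Data.Nat using (ℕ; _+_; _*_)
import Data.Nat as ℕ
open import Data.Nat.Properties using (≡ᵇ⇒≡; ≡⇒≡ᵇ)
open import Data.Product using (Σ; ∃; ∃₂; _×_; _,_; proj₁; proj₂)
open import Data.Sum using (_⊎_; [_,_])
import Data.Sum.Properties as Sum
open import Data.Unit using (tt)
open import Data.Vec using (Vec; []; _∷_; lookup)
open import Function using (_∘_; id)
open import Function.Bundles using (Equivalence)
open import Function.Definitions using (Injective)
open import Relation.Binary.PropositionalEquality using (_≡_; refl; sym; trans; subst)
open import Relation.Nullary.Decidable using (Dec; ⌊_⌋; toWitness)

_⇒ᵇ_ : Bool → Bool → Bool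
true  ⇒ᵇ b = b
false ⇒ᵇ _ = true

⇒ᵇ-sound : ∀ {a b} → T (a ⇒ᵇ b) → T a → T b
⇒ᵇ-sound {true} h _ = h

==-sound : ∀ {m} {i j : Fin m} → T (i == j) → i ≡ j
==-sound {i = i} {j} h = toℕ-injective (≡ᵇ⇒≡ (toℕ i) (toℕ j) h)

==-refl : ∀ {m} (i : Fin m) → T (i == i)
==-refl i = ≡⇒≡ᵇ (toℕ i) (toℕ i) refl

allᵇ : ∀ m → (Fin m → Bool) → Bool
allᵇ ℕ.zero    _ = true
allᵇ (ℕ.suc m) f = f zero ∧ allᵇ m (f ∘ suc)

allᵇ-sound : ∀ {m} (f : Fin m → Bool) → T (allᵇ m f) → ∀ i → T (f i)
allᵇ-sound f h zero    = proj₁ (Equivalence.to T-∧ h)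
allᵇ-sound f h (suc i) = allᵇ-sound (f ∘ suc) (proj₂ (Equivalence.to T-∧ h)) i

all⊎ᵇ : ∀ p q → (Fin p ⊎ Fin q → Bool) → Bool
all⊎ᵇ p q f = allᵇ (p + q) (f ∘ splitAt p)

all⊎ᵇ-sound : ∀ {p q} (f : Fin p ⊎ Fin q → Bool) → T (all⊎ᵇ p q f) → ∀ s → T (f s)
all⊎ᵇ-sound {p} {q} f h s = subst (T ∘ f) (splitAt-join p q s) (allᵇ-sound _ h (join p q s))

findᵇ : ∀ {a} {A : Set a} m → (Fin m → A) → (A → Bool) → Maybe A
findᵇ ℕ.zero    _ _ = nothing
findᵇ (ℕ.suc m) e f = if f (e zero) then just (e zero) else findᵇ m (e ∘ suc) f

findᵇ-sound : ∀ {a} {A : Set a} m (e : Fin m → A) f {x} → findᵇ m e f ≡ just x → T (f x)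
findᵇ-sound (ℕ.suc m) e f eq with f (e zero) in found
... | true  with refl ← eq = Equivalence.from T-≡ found
... | false = findᵇ-sound m (e ∘ suc) f eq

anyᵇ : ∀ m → (Fin m → Bool) → Bool
anyᵇ m f = is-just (findᵇ m id f)

anyᵇ-sound : ∀ {m} (f : Fin m → Bool) → T (anyᵇ m f) → ∃ λ i → T (f i)
anyᵇ-sound {m} f h with findᵇ m id f in found
... | just i  = i , findᵇ-sound m id f found
... | nothing = ⊥-elim h

IsEmbedding : (H G : Graph) → (Fin (n H) → Fin (n G)) → Set
IsEmbedding H G f = Injective _≡_ _≡_ f × (∀ i j → T (Adj H i j) → T (Adj G (f i) (f j)))

isEmbeddingᵇ : (H G : Graph) → (Fin (n H) → Fin (n G)) → Bool
isEmbeddingᵇ H G f = allᵇ (n H) λ i → allᵇ (n H) λ j →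
  ((f i == f j) ⇒ᵇ (i == j)) ∧ (Adj H i j ⇒ᵇ Adj G (f i) (f j))

isEmbeddingᵇ-sound : ∀ H G f → T (isEmbeddingᵇ H G f) → IsEmbedding H G f
isEmbeddingᵇ-sound H G f h = injective , homomorphic
  where
  at : ∀ i j → T (((f i == f j) ⇒ᵇ (i == j)) ∧ (Adj H i j ⇒ᵇ Adj G (f i) (f j)))
  at i j = allᵇ-sound _ (allᵇ-sound _ h i) j
  injective : Injective _≡_ _≡_ f
  injective {i} {j} fi≡fj =
    ==-sound (⇒ᵇ-sound (proj₁ (Equivalence.to T-∧ (at i j)))
                       (subst (λ x → T (f i == x)) fi≡fj (==-refl (f i))))
  homomorphic : ∀ i j → T (Adj H i j) → T (Adj G (f i) (f j))
  homomorphic i j = ⇒ᵇ-sound (proj₂ (Equivalence.to T-∧ (at i j)))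

copies : ∀ {m} (H G : Graph) (fs : Fin m → Fin (n H) → Fin (n G)) →
         T (allᵇ m λ a → isEmbeddingᵇ H G (fs a)) → Fin m → Copy H G
copies H G fs ok a = fs a , isEmbeddingᵇ-sound H G (fs a) (allᵇ-sound _ ok a)

module Pieces {G : Graph} {k p q : ℕ}
              (paths : Fin p → Copy (P k) G) (cycles : Fin q → Copy (C k) G) where

  Piece : Set
  Piece = Fin p ⊎ Fin q

  piece : Piece → Σ Graph λ H → Copy H G
  piece = [ (λ a → P k , paths a) , (λ b → C k , cycles b) ]

  shape : Piece → Graph
  shape s = proj₁ (piece s)

  vertexMap : (s : Piece) → Fin (n (shape s)) → Fin (n G)
  vertexMap s = proj₁ (proj₂ (piece s))

  CoveredBy : Piece → Fin (n G) → Fin (n G) → Set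
  CoveredBy s = Covers (shape s) G (proj₂ (piece s))

  Covering : Set
  Covering = ∀ u v → T (Adj G u v) → ∃ λ s → CoveredBy s u v

  EdgeDisjoint : Set
  EdgeDisjoint = ∀ s s′ u v → CoveredBy s u v → CoveredBy s′ u v → s′ ≡ s

  decomposition : k * (p + q) ≡ edgeCount G → Covering → EdgeDisjoint →
                  HasDecomposition k p q G
  decomposition count covering disjoint = count , paths , cycles , λ u v uv →
    let (s , c) = covering u v uv in s , c , λ s′ c′ → disjoint s s′ u v c c′

  OwnsItsEdges : (Fin (n G) → Fin (n G) → Maybe Piece) → Set
  OwnsItsEdges owner = ∀ s i j → T (Adj (shape s) i j) →
                         owner (vertexMap s i) (vertexMap s j) ≡ just s

  edgeDisjoint : ∀ owner → OwnsItsEdges owner → EdgeDisjoint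
  edgeDisjoint owner owns s s′ u v c c′ = just-injective (trans (sym (owned c′)) (owned c))
    where
    owned : ∀ {t} → CoveredBy t u v → owner u v ≡ just t
    owned {t} (i , j , ij , refl , refl) = owns t i j ij

  -- Testing the vertices before adjacency keeps the exhaustive checks below fast.
  coversᵇ : Piece → Fin (n G) → Fin (n G) → Bool
  coversᵇ s u v = anyᵇ (n (shape s)) λ i → (vertexMap s i == u) ∧
                  anyᵇ (n (shape s)) λ j → (vertexMap s j == v) ∧ Adj (shape s) i j

  coversᵇ-sound : ∀ s u v → T (coversᵇ s u v) → CoveredBy s u v
  coversᵇ-sound s u v h =
    let (i , hᵢ) = anyᵇ-sound _ h
        (i≡u , hⱼ) = Equivalence.to T-∧ hᵢ
        (j , hᵥ) = anyᵇ-sound _ hⱼ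
        (j≡v , ij) = Equivalence.to T-∧ hᵥ
    in i , j , ij , ==-sound i≡u , ==-sound j≡v

  firstCoveringPiece : Fin (n G) → Fin (n G) → Maybe Piece
  firstCoveringPiece u v = findᵇ (p + q) (splitAt p) λ s → coversᵇ s u v

  coveringᵇ : Bool
  coveringᵇ = allᵇ (n G) λ u → allᵇ (n G) λ v → Adj G u v ⇒ᵇ is-just (firstCoveringPiece u v)

  coveringᵇ-sound : T coveringᵇ → Covering
  coveringᵇ-sound h u v uv
    with firstCoveringPiece u v in found | ⇒ᵇ-sound (allᵇ-sound _ (allᵇ-sound _ h u) v) uv
  ... | just s  | _  = s , coversᵇ-sound s u v (findᵇ-sound (p + q) (splitAt p) _ found)
  ... | nothing | ()

  _≟ₘ_ : (x y : Maybe Piece) → Dec (x ≡ y)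
  _≟ₘ_ = Maybe.≡-dec (Sum.≡-dec _≟_ _≟_)

  ownsEdgesOfᵇ : Piece → Bool
  ownsEdgesOfᵇ s = allᵇ (n (shape s)) λ i → allᵇ (n (shape s)) λ j → Adj (shape s) i j ⇒ᵇ
    ⌊ firstCoveringPiece (vertexMap s i) (vertexMap s j) ≟ₘ just s ⌋

  ownsItsEdgesᵇ : Bool
  ownsItsEdgesᵇ = all⊎ᵇ p q ownsEdgesOfᵇ

  ownsItsEdgesᵇ-sound : T ownsItsEdgesᵇ → OwnsItsEdges firstCoveringPiece
  ownsItsEdgesᵇ-sound h s i j ij =
    toWitness (⇒ᵇ-sound (allᵇ-sound _ (allᵇ-sound _ (all⊎ᵇ-sound ownsEdgesOfᵇ h s) i) j) ij)

  decompositionBySearch : k * (p + q) ≡ edgeCount G → T coveringᵇ → T ownsItsEdgesᵇ →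
                          HasDecomposition k p q G
  decompositionBySearch count covers owns =
    decomposition count (coveringᵇ-sound covers)
                  (edgeDisjoint firstCoveringPiece (ownsItsEdgesᵇ-sound owns))

P₂×K₈ : Graph
P₂×K₈ = P 2 ⊗ K 8

-- combine is inverse to the remQuot decoding of vertices in Defs.
vertex : Fin 3 × Fin 8 → Fin (n P₂×K₈)
vertex (i , j) = combine i j

-- Numeral overloading is confined to this module so that numerals elsewhere remain natural numbers.
module VertexLists where
  open import Agda.Builtin.FromNat using (Number; fromNat)
  import Data.Fin.Literals as Fin
  import Data.Nat.Literals as Nat

  instance
    natNumber : Number ℕ
    natNumber = Nat.number
    finNumber : ∀ {m} → Number (Fin m)
    finNumber {m} = Fin.number m

  pathVertices : Vec (Vec (Fin 3 × Fin 8) 9) 9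
  pathVertices =
    ((0 , 5) ∷ (1 , 6) ∷ (2 , 1) ∷ (1 , 3) ∷ (0 , 1) ∷ (1 , 2) ∷ (2 , 4) ∷ (1 , 5) ∷ (2 , 7) ∷ []) ∷
    ((0 , 6) ∷ (1 , 5) ∷ (0 , 3) ∷ (1 , 1) ∷ (2 , 7) ∷ (1 , 4) ∷ (2 , 3) ∷ (1 , 6) ∷ (2 , 5) ∷ []) ∷
    ((0 , 7) ∷ (1 , 0) ∷ (2 , 5) ∷ (1 , 7) ∷ (2 , 4) ∷ (1 , 3) ∷ (2 , 2) ∷ (1 , 6) ∷ (0 , 1) ∷ []) ∷
    ((0 , 3) ∷ (1 , 4) ∷ (2 , 1) ∷ (1 , 2) ∷ (0 , 4) ∷ (1 , 0) ∷ (0 , 2) ∷ (1 , 5) ∷ (2 , 0) ∷ []) ∷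
    ((0 , 4) ∷ (1 , 3) ∷ (0 , 6) ∷ (1 , 7) ∷ (0 , 1) ∷ (1 , 4) ∷ (0 , 5) ∷ (1 , 1) ∷ (2 , 6) ∷ []) ∷
    ((2 , 1) ∷ (1 , 0) ∷ (2 , 7) ∷ (1 , 2) ∷ (0 , 5) ∷ (1 , 7) ∷ (2 , 0) ∷ (1 , 6) ∷ (0 , 2) ∷ []) ∷
    ((0 , 7) ∷ (1 , 2) ∷ (0 , 0) ∷ (1 , 4) ∷ (2 , 5) ∷ (1 , 3) ∷ (2 , 7) ∷ (1 , 6) ∷ (2 , 4) ∷ []) ∷
    ((0 , 0) ∷ (1 , 6) ∷ (0 , 3) ∷ (1 , 0) ∷ (0 , 1) ∷ (1 , 5) ∷ (2 , 1) ∷ (1 , 7) ∷ (2 , 3) ∷ []) ∷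
    ((0 , 7) ∷ (1 , 1) ∷ (0 , 2) ∷ (1 , 3) ∷ (2 , 0) ∷ (1 , 2) ∷ (0 , 6) ∷ (1 , 4) ∷ (2 , 2) ∷ []) ∷ []

  cycleVertices : Vec (Vec (Fin 3 × Fin 8) 8) 5
  cycleVertices =
    ((0 , 4) ∷ (1 , 6) ∷ (0 , 7) ∷ (1 , 4) ∷ (2 , 6) ∷ (1 , 5) ∷ (0 , 0) ∷ (1 , 1) ∷ []) ∷
    ((0 , 0) ∷ (1 , 7) ∷ (0 , 3) ∷ (1 , 2) ∷ (2 , 3) ∷ (1 , 0) ∷ (0 , 5) ∷ (1 , 3) ∷ []) ∷
    ((0 , 2) ∷ (1 , 7) ∷ (2 , 2) ∷ (1 , 0) ∷ (0 , 6) ∷ (1 , 1) ∷ (2 , 0) ∷ (1 , 4) ∷ []) ∷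
    ((2 , 2) ∷ (1 , 1) ∷ (2 , 5) ∷ (1 , 2) ∷ (2 , 6) ∷ (1 , 3) ∷ (0 , 7) ∷ (1 , 5) ∷ []) ∷
    ((1 , 0) ∷ (2 , 6) ∷ (1 , 7) ∷ (0 , 4) ∷ (1 , 5) ∷ (2 , 3) ∷ (1 , 1) ∷ (2 , 4) ∷ []) ∷ []

open VertexLists using (pathVertices; cycleVertices)

paths : Fin 9 → Copy (P 8) P₂×K₈
paths = copies (P 8) P₂×K₈ (λ a → vertex ∘ lookup (lookup pathVertices a)) tt

cycles : Fin 5 → Copy (C 8) P₂×K₈
cycles = copies (C 8) P₂×K₈ (λ b → vertex ∘ lookup (lookup cycleVertices b)) tt

mainTheorem9 : ∃₂ λ (p q : ℕ) → HasDecomposition 8 p q (P 2 ⊗ K 8)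
mainTheorem9 = 9 , 5 , decompositionBySearch refl tt tt
  where open Pieces {G = P₂×K₈} paths cycles
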